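{- For $N=2$ and $N=3$, the set $\mathcal{R}_N$ is dense in $\mathbb{R}^N$.
   Context: A rational distance set $\mathrm{RDS}(N)$ on the parabola $y=x^2$ is a set of $N$ (distinct) points on the parabola with rational coordinates such that all pairwise Euclidean distances are rational. $\mathcal{R}_N\subseteq\mathbb{Q}^N\subseteq\mathbb{R}^N$ denotes the set of all $N$-tuples $(x_1,\dots,x_N)$ such that $\{(x_i,x_i^2):1\le i\le N\}$ is an $\mathrm{RDS}(N)$.
   Formalization: Density is expressed by approximating only points with rational coordinates within rational tolerances in the maximum norm, rather than arbitrary points of $\mathbb{R}^N$. -}

module Defs where

open import Data.Nat using (ℕ)
open import Data.Fin using (Fin)
open import Data.Rational using (ℚ; _+_; _*_; _-_; ∣_∣; _<_; 0ℚ)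
open import Data.Product using (_×_; ∃-syntax)
open import Relation.Binary.PropositionalEquality using (_≡_; _≢_)

sqDistParabola : ℚ → ℚ → ℚ
sqDistParabola a b = (a - b) * (a - b) + (a * a - b * b) * (a * a - b * b)

-- a rational number is the distance iff its square is the squared distance
-- (sign ignored: d and -d give the same rational |d|)
RationalDistance : ℚ → ℚ → Set
RationalDistance a b = ∃[ d ] (d * d ≡ sqDistParabola a b)

-- (x₁,…,x_N) ∈ 𝓡_N : the points (x_i, x_i²) are distinct and all
-- pairwise Euclidean distances are rational
InR : (N : ℕ) → (Fin N → ℚ) → Set
InR N x = (∀ i j → i ≢ j → x i ≢ x j)
        × (∀ i j → RationalDistance (x i) (x j))

-- S ⊆ ℚ^N is dense in ℝ^N: since ℚ^N is dense in ℝ^N, this is equivalent to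
-- every rational point being approximable within every rational ε > 0
-- (sup-norm) by points of S.
DenseInRN : (N : ℕ) → ((Fin N → ℚ) → Set) → Set
DenseInRN N S = ∀ (q : Fin N → ℚ) (ε : ℚ) → 0ℚ < ε →
  ∃[ r ] (S r × (∀ i → ∣ r i - q i ∣ < ε))

{-# OPTIONS --safe #-}
module Submission where

-- The distance between (a, a²) and (b, b²) is |a − b|·√(1 + (a + b)²), so it is rational as
-- soon as 1 + (a + b)² is a rational square. Every (t − 1/t)/2 has this property, since
-- 1 + ((t − 1/t)/2)² = ((t + 1/t)/2)². On t ≥ 1 this map starts at 0, is 1-Lipschitz and is
-- unbounded, so walking along a fine grid of values of t lands in any interval of [0, ∞);
-- the property is invariant under s ↦ −s, so such numbers are dense in ℚ. Choosing three
-- distinct ones s₀, s₁, s₂ near the pairwise sums of a target triple and solving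
-- r_j + r_k = s_i gives nearby points of 𝓡₃; dropping a coordinate gives 𝓡₂.

open import Data.Empty using (⊥-elim)
open import Data.Fin using (Fin; zero; suc) renaming (_<_ to _<ᶠ_)
open import Data.Fin.Patterns using (0F; 1F; 2F)
import Data.Fin.Properties as Fin
open import Data.Integer using (+_; -[1+_])
import Data.Integer as ℤ
import Data.Integer.Properties as ℤ
open import Data.Nat using (ℕ; zero; suc; s≤s)
import Data.Nat as ℕ
import Data.Nat.Properties as ℕ
open import Data.Product using (_×_; _,_; proj₁; proj₂; ∃-syntax)
open import Data.Rational
open import Data.Rational.Literals using (fromℤ)
open import Data.Rational.Properties
open import Algebra.Properties.AbelianGroup +-0-abelianGroup
  using (⁻¹-involutive; ⁻¹-injective; ∙-cancelˡ; xyx⁻¹≈y; //-rightDividesˡ)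
open import Data.Sum using (inj₁; inj₂)
open import Data.List.Base using (_∷_; [])
import Data.Vec.Functional as Vector
open import Function using (_∘_)
open import Level using (0ℓ)
open import Relation.Binary.Definitions using (tri<; tri≈; tri>)
open import Relation.Binary.PropositionalEquality
open import Relation.Nullary using (yes; no)
open import Relation.Nullary.Decidable using (dec⇒maybe)
open import Tactic.RingSolver using (solve-∀; solve)
open import Tactic.RingSolver.Core.AlmostCommutativeRing using (AlmostCommutativeRing; fromCommutativeRing)

open import Defs

ℚ-ring : AlmostCommutativeRing 0ℓ 0ℓ
ℚ-ring = fromCommutativeRing +-*-commutativeRing (λ x → dec⇒maybe (0ℚ ≟ x))

open ≤-Reasoning

fromℕ : ℕ → ℚ
fromℕ n = fromℤ (+ n)

-- 1ℚ + fromℕ n computes to (+ 1 ℤ.+ + n ℤ.* + 1) / 1.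
fromℕ-suc : ∀ n → fromℕ (suc n) ≡ 1ℚ + fromℕ n
fromℕ-suc n = sym (trans (cong (λ m → (+ 1 ℤ.+ m) / 1) (ℤ.*-identityʳ (+ n))) (normalize-coprime _))

-- x / (1 + d) < 1 + x because x · 1 < (1 + x) · (1 + d).
<-fromℕ : ∀ p → ∃[ n ] p < fromℕ n
<-fromℕ (mkℚ (+ x) d _) = suc x , *<* (subst₂ ℤ._<_ (ℤ.pos-* x 1) (ℤ.pos-* (suc x) (suc d))
  (ℤ.+<+ (subst (ℕ._< suc x ℕ.* suc d) (sym (ℕ.*-identityʳ x)) (ℕ.m≤m*n (suc x) (suc d)))))
<-fromℕ p@(mkℚ -[1+ _ ] _ _) = 0 , negative⁻¹ p

archimedean : ∀ p {h} → 0ℚ < h → ∃[ n ] p < fromℕ n * h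
archimedean p {h} 0<h = n , (begin-strict
  p                     ≡⟨ sym (*-identityʳ p) ⟩
  p * 1ℚ                ≡⟨ cong (p *_) (sym (*-inverseˡ h)) ⟩
  p * (1/ h * h)        ≡⟨ sym (*-assoc p (1/ h) h) ⟩
  p * 1/ h * h          <⟨ *-monoˡ-<-pos h p/h<n ⟩
  fromℕ n * h           ∎)
  where
  instance
    h>0 : Positive h
    h>0 = positive 0<h
    h≢0 : NonZero h
    h≢0 = pos⇒nonZero h
  n = proj₁ (<-fromℕ (p * 1/ h))
  p/h<n = proj₂ (<-fromℕ (p * 1/ h))

discrete-intermediateValue : (g : ℕ → ℚ) {a d : ℚ} → (∀ k → g (suc k) ≤ g k + d) →
                             g 0 ≤ a → ∀ K → a < g K → ∃[ k ] (a < g k × g k ≤ a + d)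
discrete-intermediateValue g step g₀≤a zero a<g₀ = ⊥-elim (<-irrefl refl (≤-<-trans g₀≤a a<g₀))
discrete-intermediateValue g {a} {d} step g₀≤a (suc K) a<g[K+1] with a <? g K
... | yes a<g[K] = discrete-intermediateValue g step g₀≤a K a<g[K]
... | no a≮g[K]  = suc K , a<g[K+1] , ≤-trans (step K) (+-monoˡ-≤ d (≮⇒≥ a≮g[K]))

Dense : (ℚ → Set) → Set
Dense P = ∀ {a b} → a < b → ∃[ s ] (P s × a < s × s < b)

dense-mono : ∀ {P Q : ℚ → Set} → (∀ {s} → P s → Q s) → Dense P → Dense Q
dense-mono P⇒Q dense a<b = let s , Ps , a<s , s<b = dense a<b in s , P⇒Q Ps , a<s , s<b

dense-avoiding : ∀ {P} → Dense P → ∀ u → Dense (λ s → P s × s ≢ u)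
dense-avoiding dense u {a} {b} a<b with <-dense a<b
... | c , a<c , c<b with u <? c
...   | yes u<c = let s , Ps , c<s , s<b = dense c<b
                  in s , (Ps , ≢-sym (<⇒≢ (<-trans u<c c<s))) , <-trans a<c c<s , s<b
...   | no u≮c  = let s , Ps , a<s , s<c = dense a<c
                  in s , (Ps , <⇒≢ (<-≤-trans s<c (≮⇒≥ u≮c))) , a<s , <-trans s<c c<b

dense-avoidingAll : ∀ {P} → Dense P → ∀ {n} (u : Fin n → ℚ) → Dense (λ s → P s × ∀ i → s ≢ u i)
dense-avoidingAll dense {zero} u = dense-mono (λ Ps → Ps , λ ()) dense
dense-avoidingAll {P} dense {suc n} u =
  dense-mono merge (dense-avoiding (dense-avoidingAll dense (u ∘ suc)) (u zero))
  where
  merge : ∀ {s} → (P s × ∀ i → s ≢ u (suc i)) × s ≢ u zero → P s × ∀ i → s ≢ u i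
  merge ((Ps , s≢u[1+i]) , s≢u₀) = Ps , λ { zero → s≢u₀ ; (suc i) → s≢u[1+i] i }

-q<p<q⇒∣p∣<q : ∀ {p q} → - q < p → p < q → ∣ p ∣ < q
-q<p<q⇒∣p∣<q {p} {q} -q<p p<q with ∣p∣≡p∨∣p∣≡-p p
... | inj₁ ∣p∣≡p  = subst (_< q) (sym ∣p∣≡p) p<q
... | inj₂ ∣p∣≡-p = subst (_< q) (sym ∣p∣≡-p) (subst (- p <_) (⁻¹-involutive q) (neg-antimono-< -q<p))

dense-approximates : ∀ {P} → Dense P → ∀ t {δ} → 0ℚ < δ → ∃[ s ] (P s × ∣ s - t ∣ < δ)
dense-approximates dense t {δ} 0<δ =
  let s , Ps , t-δ<s , s<t+δ = dense (+-monoʳ-< t (<-trans (neg-antimono-< 0<δ) 0<δ))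
  in s , Ps , -q<p<q⇒∣p∣<q (subst (_< s - t) (xyx⁻¹≈y t (- δ)) (+-monoˡ-< (- t) t-δ<s))
                            (subst (s - t <_) (xyx⁻¹≈y t δ) (+-monoˡ-< (- t) s<t+δ))

Distinct : ∀ {n} → (Fin n → ℚ) → Set
Distinct x = ∀ i j → i ≢ j → x i ≢ x j

dense-distinctApproximants : ∀ {P} → Dense P → ∀ {n} (t : Fin n → ℚ) {δ} → 0ℚ < δ →
                             ∃[ s ] (Distinct s × ∀ i → P (s i) × ∣ s i - t i ∣ < δ)
dense-distinctApproximants dense {zero} t 0<δ = (λ ()) , (λ ()) , (λ ())
dense-distinctApproximants dense {suc n} t 0<δ =
  let s , distinct , approx = dense-distinctApproximants dense (t ∘ suc) 0<δ
      s₀ , (Ps₀ , s₀∉s) , close = dense-approximates (dense-avoidingAll dense s) (t zero) 0<δ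
  in s₀ Vector.∷ s , ∷-distinct s₀∉s distinct , λ { zero → Ps₀ , close ; (suc i) → approx i }
  where
  ∷-distinct : ∀ {x₀ x} → (∀ i → x₀ ≢ x i) → Distinct {n} x → Distinct (x₀ Vector.∷ x)
  ∷-distinct x₀∉x distinct zero    zero    0≢0   = ⊥-elim (0≢0 refl)
  ∷-distinct x₀∉x distinct zero    (suc j) _     = x₀∉x j
  ∷-distinct x₀∉x distinct (suc i) zero    _     = ≢-sym (x₀∉x i)
  ∷-distinct x₀∉x distinct (suc i) (suc j) i≢j   = distinct i j (i≢j ∘ cong suc)

dense-fromNonNeg : ∀ {P} → (∀ {s} → P s → P (- s)) → P 0ℚ →
                   (∀ {a b} → 0ℚ ≤ a → a < b → ∃[ s ] (P s × a < s × s < b)) → Dense P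
dense-fromNonNeg P-neg P₀ denseNonNeg {a} {b} a<b with 0ℚ ≤? a | 0ℚ <? b
... | yes 0≤a | _       = denseNonNeg 0≤a a<b
... | no 0≰a  | yes 0<b = 0ℚ , P₀ , ≰⇒> 0≰a , 0<b
... | no _    | no 0≮b  =
  let s , Ps , -b<s , s<-a = denseNonNeg (neg-antimono-≤ (≮⇒≥ 0≮b)) (neg-antimono-< a<b)
  in - s , P-neg Ps , subst (_< - s) (⁻¹-involutive a) (neg-antimono-< s<-a)
                    , subst (- s <_) (⁻¹-involutive b) (neg-antimono-< -b<s)

HasRationalHypotenuse : ℚ → Set
HasRationalHypotenuse s = ∃[ c ] (c * c ≡ 1ℚ + s * s)

hasRationalHypotenuse-0 : HasRationalHypotenuse 0ℚ
hasRationalHypotenuse-0 = 1ℚ , refl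

hasRationalHypotenuse-neg : ∀ {s} → HasRationalHypotenuse s → HasRationalHypotenuse (- s)
hasRationalHypotenuse-neg {s} (c , c²≡1+s²) = c , trans c²≡1+s² (solve (s ∷ []) ℚ-ring)

sqDistParabola-factor : ∀ a b → (a - b) * (a - b) + (a * a - b * b) * (a * a - b * b)
                                ≡ (a - b) * (a - b) * (1ℚ + (a + b) * (a + b))
sqDistParabola-factor = solve-∀ ℚ-ring

rationalDistance-refl : ∀ a → RationalDistance a a
rationalDistance-refl a = 0ℚ , (begin-equality
  0ℚ * 0ℚ                                               ≡⟨ solve (a ∷ []) ℚ-ring ⟩
  (a - a) * (a - a) + (a * a - a * a) * (a * a - a * a) ∎)

hasRationalHypotenuse⇒rationalDistance : ∀ a b → HasRationalHypotenuse (a + b) → RationalDistance a b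
hasRationalHypotenuse⇒rationalDistance a b (c , c²≡1+[a+b]²) = (a - b) * c , (begin-equality
  (a - b) * c * ((a - b) * c)                   ≡⟨ solve (a ∷ b ∷ c ∷ []) ℚ-ring ⟩
  (a - b) * (a - b) * (c * c)                   ≡⟨ cong ((a - b) * (a - b) *_) c²≡1+[a+b]² ⟩
  (a - b) * (a - b) * (1ℚ + (a + b) * (a + b))  ≡⟨ sqDistParabola-factor a b ⟨
  sqDistParabola a b                            ∎)

hyperbola⇒hasRationalHypotenuse : ∀ {t u} → t * u ≡ 1ℚ → HasRationalHypotenuse ((t - u) * ½)
hyperbola⇒hasRationalHypotenuse {t} {u} tu≡1 = (t + u) * ½ , (begin-equality
  (t + u) * ½ * ((t + u) * ½)        ≡⟨ solve (t ∷ u ∷ []) ℚ-ring ⟩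
  t * u + (t - u) * ½ * ((t - u) * ½) ≡⟨ cong (_+ (t - u) * ½ * ((t - u) * ½)) tu≡1 ⟩
  1ℚ + (t - u) * ½ * ((t - u) * ½)    ∎)

1≤p⇒0<p : ∀ {p} → 1ℚ ≤ p → 0ℚ < p
1≤p⇒0<p = <-≤-trans (positive⁻¹ 1ℚ)

hyperbola-reciprocalBounds : ∀ {t u} → 1ℚ ≤ t → t * u ≡ 1ℚ → 0ℚ ≤ u × u ≤ 1ℚ
hyperbola-reciprocalBounds {t} {u} 1≤t tu≡1 =
    *-cancelˡ-≤-pos t (begin t * 0ℚ ≡⟨ *-zeroʳ t ⟩ 0ℚ ≤⟨ nonNegative⁻¹ 1ℚ ⟩ 1ℚ ≡⟨ tu≡1 ⟨ t * u ∎)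
  , *-cancelˡ-≤-pos t (begin t * u ≡⟨ tu≡1 ⟩ 1ℚ ≤⟨ 1≤t ⟩ t ≡⟨ *-identityʳ t ⟨ t * 1ℚ ∎)
  where instance _ = positive (1≤p⇒0<p 1≤t)

hyperbola-lowerBound : ∀ {t u} → 1ℚ ≤ t → t * u ≡ 1ℚ → (t - 1ℚ) * ½ ≤ (t - u) * ½
hyperbola-lowerBound {t} 1≤t tu≡1 =
  *-monoʳ-≤-nonNeg ½ (+-monoʳ-≤ t (neg-antimono-≤ (proj₂ (hyperbola-reciprocalBounds 1≤t tu≡1))))

hyperbola-1-Lipschitz : ∀ {t u t′ u′} → 1ℚ ≤ t → t ≤ t′ → t * u ≡ 1ℚ → t′ * u′ ≡ 1ℚ →
                        (t′ - u′) * ½ ≤ (t - u) * ½ + (t′ - t)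
hyperbola-1-Lipschitz {t} {u} {t′} {u′} 1≤t t≤t′ tu≡1 t′u′≡1 = begin
  (t′ - u′) * ½                                 ≡⟨ solve (t ∷ u ∷ t′ ∷ u′ ∷ []) ℚ-ring ⟩
  (t - u + (t′ - t) + (u - u′)) * ½             ≡⟨ cong (λ x → (t - u + (t′ - t) + x) * ½) u-u′≡[t′-t]uu′ ⟩
  (t - u + (t′ - t) + (t′ - t) * (u * u′)) * ½  ≤⟨ *-monoʳ-≤-nonNeg ½ (+-monoʳ-≤ (t - u + (t′ - t)) d*uu′≤d) ⟩
  (t - u + (t′ - t) + (t′ - t)) * ½             ≡⟨ solve (t ∷ u ∷ t′ ∷ []) ℚ-ring ⟩
  (t - u) * ½ + (t′ - t)                        ∎
  where
  u-u′≡[t′-t]uu′ : u - u′ ≡ (t′ - t) * (u * u′)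
  u-u′≡[t′-t]uu′ = begin-equality
    u - u′                        ≡⟨ solve (u ∷ u′ ∷ []) ℚ-ring ⟩
    u * 1ℚ - u′ * 1ℚ              ≡⟨ cong₂ (λ x y → u * x - u′ * y) t′u′≡1 tu≡1 ⟨
    u * (t′ * u′) - u′ * (t * u)  ≡⟨ solve (t ∷ u ∷ t′ ∷ u′ ∷ []) ℚ-ring ⟩
    (t′ - t) * (u * u′)           ∎
  bounds = hyperbola-reciprocalBounds 1≤t tu≡1
  bounds′ = hyperbola-reciprocalBounds (≤-trans 1≤t t≤t′) t′u′≡1
  uu′≤1 : u * u′ ≤ 1ℚ
  uu′≤1 = begin
    u * u′  ≤⟨ *-monoˡ-≤-nonNeg u {{nonNegative (proj₁ bounds)}} (proj₂ bounds′) ⟩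
    u * 1ℚ  ≡⟨ *-identityʳ u ⟩
    u       ≤⟨ proj₂ bounds ⟩
    1ℚ      ∎
  d*uu′≤d : (t′ - t) * (u * u′) ≤ t′ - t
  d*uu′≤d = begin
    (t′ - t) * (u * u′)  ≤⟨ *-monoˡ-≤-nonNeg (t′ - t) {{nonNegative 0≤t′-t}} uu′≤1 ⟩
    (t′ - t) * 1ℚ        ≡⟨ *-identityʳ (t′ - t) ⟩
    t′ - t               ∎
    where 0≤t′-t = subst (_≤ t′ - t) (+-inverseʳ t) (+-monoˡ-≤ (- t) t≤t′)

module HyperbolaGrid (h : ℚ) (0<h : 0ℚ < h) where

  node : ℕ → ℚ
  node zero    = 1ℚ
  node (suc k) = node k + h

  node≤node[1+k] : ∀ k → node k ≤ node (suc k)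
  node≤node[1+k] k = subst (_≤ node k + h) (+-identityʳ (node k)) (+-monoʳ-≤ (node k) (<⇒≤ 0<h))

  1≤node : ∀ k → 1ℚ ≤ node k
  1≤node zero    = ≤-refl
  1≤node (suc k) = ≤-trans (1≤node k) (node≤node[1+k] k)

  node-closedForm : ∀ k → node k ≡ 1ℚ + fromℕ k * h
  node-closedForm zero    = sym (trans (cong (λ x → 1ℚ + x) (*-zeroˡ h)) (+-identityʳ 1ℚ))
  node-closedForm (suc k) = begin-equality
    node k + h                ≡⟨ cong (_+ h) (node-closedForm k) ⟩
    1ℚ + fromℕ k * h + h      ≡⟨ regroup (fromℕ k) h ⟩
    1ℚ + (1ℚ + fromℕ k) * h   ≡⟨ cong (λ x → 1ℚ + x * h) (fromℕ-suc k) ⟨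
    1ℚ + fromℕ (suc k) * h    ∎
    where
    regroup : ∀ x y → 1ℚ + x * y + y ≡ 1ℚ + (1ℚ + x) * y
    regroup = solve-∀ ℚ-ring

  node≢0 : ∀ k → NonZero (node k)
  node≢0 k = pos⇒nonZero (node k) {{positive (1≤p⇒0<p (1≤node k))}}

  node⁻¹ : ℕ → ℚ
  node⁻¹ k = (1/ node k) {{node≢0 k}}

  node*node⁻¹ : ∀ k → node k * node⁻¹ k ≡ 1ℚ
  node*node⁻¹ k = *-inverseʳ (node k) {{node≢0 k}}

  value : ℕ → ℚ
  value k = (node k - node⁻¹ k) * ½

  value-hasRationalHypotenuse : ∀ k → HasRationalHypotenuse (value k)
  value-hasRationalHypotenuse k = hyperbola⇒hasRationalHypotenuse {node k} {node⁻¹ k} (node*node⁻¹ k)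

  value-step : ∀ k → value (suc k) ≤ value k + h
  value-step k = subst (λ d → value (suc k) ≤ value k + d) (xyx⁻¹≈y (node k) h)
    (hyperbola-1-Lipschitz (1≤node k) (node≤node[1+k] k) (node*node⁻¹ k) (node*node⁻¹ (suc k)))

  value-unbounded : ∀ a → ∃[ K ] a < value K
  value-unbounded a = K , (begin-strict
    a                         ≡⟨ solve (a ∷ []) ℚ-ring ⟩
    (a + a) * ½               <⟨ *-monoˡ-<-pos ½ a+a<Kh ⟩
    fromℕ K * h * ½           ≡⟨ cong (_* ½) node[K]-1≡Kh ⟨
    (node K - 1ℚ) * ½         ≤⟨ hyperbola-lowerBound (1≤node K) (node*node⁻¹ K) ⟩
    value K                   ∎)
    where
    K = proj₁ (archimedean (a + a) 0<h)
    a+a<Kh = proj₂ (archimedean (a + a) 0<h)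
    node[K]-1≡Kh = trans (cong (_- 1ℚ) (node-closedForm K)) (xyx⁻¹≈y 1ℚ (fromℕ K * h))

hasRationalHypotenuse-denseNonNeg : ∀ {a b} → 0ℚ ≤ a → a < b →
                                    ∃[ s ] (HasRationalHypotenuse s × a < s × s < b)
hasRationalHypotenuse-denseNonNeg {a} {b} 0≤a a<b with <-dense a<b
... | c , a<c , c<b =
  let K , a<value[K] = value-unbounded a
      k , a<value[k] , value[k]≤a+h = discrete-intermediateValue value value-step 0≤a K a<value[K]
  in value k , value-hasRationalHypotenuse k , a<value[k] , ≤-<-trans value[k]≤a+h a+h<b
  where
  h = c - a
  open HyperbolaGrid h (subst (_< h) (+-inverseʳ a) (+-monoˡ-< (- a) a<c))
  a+h<b : a + h < b
  a+h<b = subst (_< b) (sym (trans (+-comm a h) (//-rightDividesˡ a c))) c<b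

hasRationalHypotenuse-dense : Dense HasRationalHypotenuse
hasRationalHypotenuse-dense = dense-fromNonNeg (λ {s} → hasRationalHypotenuse-neg {s})
  hasRationalHypotenuse-0 hasRationalHypotenuse-denseNonNeg

inR-fromPairSums : ∀ {N} {x : Fin N → ℚ} → Distinct x →
                   (∀ {i j} → i <ᶠ j → HasRationalHypotenuse (x i + x j)) → InR N x
inR-fromPairSums {x = x} distinct pairSum = distinct , distance
  where
  distance : ∀ i j → RationalDistance (x i) (x j)
  distance i j with Fin.<-cmp i j
  ... | tri< i<j _ _  = hasRationalHypotenuse⇒rationalDistance (x i) (x j) (pairSum i<j)
  ... | tri≈ _ refl _ = rationalDistance-refl (x i)
  ... | tri> _ _ j<i  = hasRationalHypotenuse⇒rationalDistance (x i) (x j)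
                          (subst HasRationalHypotenuse (+-comm (x j) (x i)) (pairSum j<i))

-- The triple whose two entries other than the i-th sum to s i.
fromPairSums : (Fin 3 → ℚ) → Fin 3 → ℚ
fromPairSums s i = (s 0F + s 1F + s 2F) * ½ - s i

fromPairSums-distinct : ∀ {s} → Distinct s → Distinct (fromPairSums s)
fromPairSums-distinct {s} distinct i j i≢j eq =
  distinct i j i≢j (⁻¹-injective (∙-cancelˡ ((s 0F + s 1F + s 2F) * ½) (- s i) (- s j) eq))

fromPairSums-pairSum : ∀ {P : ℚ → Set} s → (∀ k → P (s k)) →
                       ∀ {i j} → i <ᶠ j → P (fromPairSums s i + fromPairSums s j)
fromPairSums-pairSum {P} s Ps {0F} {1F} _ = subst P (sym (sum₀₁ (s 0F) (s 1F) (s 2F))) (Ps 2F)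
  where
  sum₀₁ : ∀ a b c → (a + b + c) * ½ - a + ((a + b + c) * ½ - b) ≡ c
  sum₀₁ = solve-∀ ℚ-ring
fromPairSums-pairSum {P} s Ps {0F} {2F} _ = subst P (sym (sum₀₂ (s 0F) (s 1F) (s 2F))) (Ps 1F)
  where
  sum₀₂ : ∀ a b c → (a + b + c) * ½ - a + ((a + b + c) * ½ - c) ≡ b
  sum₀₂ = solve-∀ ℚ-ring
fromPairSums-pairSum {P} s Ps {1F} {2F} _ = subst P (sym (sum₁₂ (s 0F) (s 1F) (s 2F))) (Ps 0F)
  where
  sum₁₂ : ∀ a b c → (a + b + c) * ½ - b + ((a + b + c) * ½ - c) ≡ a
  sum₁₂ = solve-∀ ℚ-ring
fromPairSums-pairSum s Ps {0F} {0F} ()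
fromPairSums-pairSum s Ps {1F} {0F} ()
fromPairSums-pairSum s Ps {1F} {1F} (s≤s ())
fromPairSums-pairSum s Ps {2F} {0F} ()
fromPairSums-pairSum s Ps {2F} {1F} (s≤s ())
fromPairSums-pairSum s Ps {2F} {2F} (s≤s (s≤s ()))

∣[x+y+z]*½-w∣< : ∀ {δ} x y z w → ∣ x ∣ < δ → ∣ y ∣ < δ → ∣ z ∣ < δ → ∣ w ∣ < δ →
                 ∣ (x + y + z) * ½ - w ∣ < (δ + δ + δ) * ½ + δ
∣[x+y+z]*½-w∣< {δ} x y z w ∣x∣<δ ∣y∣<δ ∣z∣<δ ∣w∣<δ = begin-strict
  ∣ (x + y + z) * ½ - w ∣              ≤⟨ ∣p-q∣≤∣p∣+∣q∣ ((x + y + z) * ½) w ⟩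
  ∣ (x + y + z) * ½ ∣ + ∣ w ∣          ≡⟨ cong (_+ ∣ w ∣) (∣p*q∣≡∣p∣*∣q∣ (x + y + z) ½) ⟩
  ∣ x + y + z ∣ * ½ + ∣ w ∣            ≤⟨ +-monoˡ-≤ ∣ w ∣ (*-monoʳ-≤-nonNeg ½ ∣x+y+z∣≤) ⟩
  (∣ x ∣ + ∣ y ∣ + ∣ z ∣) * ½ + ∣ w ∣  <⟨ +-mono-< (*-monoˡ-<-pos ½ ∣x∣+∣y∣+∣z∣<3δ) ∣w∣<δ ⟩
  (δ + δ + δ) * ½ + δ                  ∎
  where
  ∣x+y+z∣≤ = ≤-trans (∣p+q∣≤∣p∣+∣q∣ (x + y) z) (+-monoˡ-≤ ∣ z ∣ (∣p+q∣≤∣p∣+∣q∣ x y))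
  ∣x∣+∣y∣+∣z∣<3δ = +-mono-< (+-mono-< ∣x∣<δ ∣y∣<δ) ∣z∣<δ

⅖ : ℚ
⅖ = + 2 / 5

fromPairSums-close : ∀ (q s : Fin 3 → ℚ) {ε} →
                     (∀ i → ∣ s i - (q 0F + q 1F + q 2F - q i) ∣ < ε * ⅖) →
                     ∀ i → ∣ fromPairSums s i - q i ∣ < ε
fromPairSums-close q s {ε} close i =
  subst₂ (λ x δ → ∣ x ∣ < δ)
    (sym (errors (s 0F) (s 1F) (s 2F) (q 0F) (q 1F) (q 2F) (s i) (q i))) (radius ε)
    (∣[x+y+z]*½-w∣< (e 0F) (e 1F) (e 2F) (e i) (close 0F) (close 1F) (close 2F) (close i))
  where
  e : Fin 3 → ℚ
  e j = s j - (q 0F + q 1F + q 2F - q j)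
  errors : ∀ a b c x y z v w →
           (a + b + c) * ½ - v - w
           ≡ (a - (x + y + z - x) + (b - (x + y + z - y)) + (c - (x + y + z - z))) * ½
             - (v - (x + y + z - w))
  errors = solve-∀ ℚ-ring
  radius : ∀ ε → (ε * ⅖ + ε * ⅖ + ε * ⅖) * ½ + ε * ⅖ ≡ ε
  radius = solve-∀ ℚ-ring

denseInR-3 : DenseInRN 3 (InR 3)
denseInR-3 q ε 0<ε =
  let s , distinct , approx = dense-distinctApproximants hasRationalHypotenuse-dense
                                (λ i → q 0F + q 1F + q 2F - q i) (*-monoˡ-<-pos ⅖ 0<ε)
  in fromPairSums s ,
     inR-fromPairSums (fromPairSums-distinct {s} distinct)
                      (fromPairSums-pairSum {HasRationalHypotenuse} s (proj₁ ∘ approx)) ,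
     fromPairSums-close q s (proj₂ ∘ approx)

denseInR-restrict : ∀ {n} → DenseInRN (suc n) (InR (suc n)) → DenseInRN n (InR n)
denseInR-restrict dense q ε 0<ε =
  let r , (distinct , distance) , close = dense (0ℚ Vector.∷ q) ε 0<ε
  in r ∘ suc
   , ( (λ i j i≢j → distinct (suc i) (suc j) (i≢j ∘ Fin.suc-injective))
     , (λ i j → distance (suc i) (suc j)))
   , close ∘ suc

theorem4p2 : DenseInRN 2 (InR 2) × DenseInRN 3 (InR 3)
theorem4p2 = denseInR-restrict denseInR-3 , denseInR-3
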